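{- Let $T$ be a binary tree (every vertex has degree $1$ or $3$), $L$ a set of links each joining two leaves of $T$, and $x$ a feasible solution to the NODE-LP. Then no vertex of $T$ is incident to three deficient edges; that is, the deficient edges form vertex-disjoint paths in $T$.
   Context: A link $\ell$ covers a tree edge $e$ if $e$ lies on the unique path in $T$ between the endpoints of $\ell$; $\delta(e)$ is the set of links covering $e$, $x(F)=\sum_{\ell\in F}x_\ell$. The NODE-LP consists of the constraints $x(\delta(e))\ge1$ for every tree edge $e$, $x(\delta(e_1)\cup\delta(e_2)\cup\delta(e_3))\ge 2$ for every vertex $v$ of degree $3$ with incident tree edges $e_1,e_2,e_3$, and $x\ge0$. A tree edge $e$ is deficient if $x(\delta(e))<4/3$.
   Formalization: The feasible solution $x$ to the NODE-LP has rational entries. -}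

module Defs where

open import Data.Nat as ℕ using (ℕ; suc)
open import Data.Fin using (Fin)
open import Data.Fin.Properties using (_≟_)
open import Data.List using (List; []; _∷_; head; last; length; filter; tabulate)
open import Data.List.Relation.Unary.Linked using (Linked)
open import Data.List.Relation.Unary.AllPairs using (AllPairs)
open import Data.List.Relation.Unary.Unique.Propositional using (Unique)
open import Data.Maybe using (just)
open import Data.Product using (_×_; Σ; ∃; proj₁; proj₂; _,_)
open import Data.Sum using (_⊎_)
open import Data.Bool using (Bool; true; false; if_then_else_)
open import Data.Rational using (ℚ; 0ℚ; _+_; _≤_; _<_; _/_)
open import Data.Integer using (+_)
open import Data.Vec.Functional using (Vector; foldr)
open import Relation.Nullary using (¬_; Dec; yes; no)
open import Relation.Nullary.Decidable using (_⊎-dec_)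
open import Relation.Binary.PropositionalEquality using (_≡_; _≢_)
open import Function.Bundles using (_⇔_)

EdgeList : ℕ → ℕ → Set
EdgeList n m = Fin m → Fin n × Fin n

module _ {n m : ℕ} (E : EdgeList n m) where

  Joins : Fin m → Fin n → Fin n → Set
  Joins i u w = (proj₁ (E i) ≡ u × proj₂ (E i) ≡ w) ⊎ (proj₁ (E i) ≡ w × proj₂ (E i) ≡ u)

  Adj : Fin n → Fin n → Set
  Adj u w = ∃ λ i → Joins i u w

  Simple : Set
  Simple = (∀ i → proj₁ (E i) ≢ proj₂ (E i))
         × (∀ i j → Joins i (proj₁ (E j)) (proj₂ (E j)) → i ≡ j)

  IsPath : Fin n → Fin n → List (Fin n) → Set
  IsPath a b P = head P ≡ just a × last P ≡ just b × Linked Adj P × Unique P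

  Connected : Set
  Connected = ∀ a b → ∃ λ P → IsPath a b P

  IsCycle : List (Fin n) → Set
  IsCycle C = 3 ℕ.≤ length C × Linked Adj C × Unique C
            × (∃ λ u → ∃ λ w → head C ≡ just u × last C ≡ just w × Adj w u)

  Acyclic : Set
  Acyclic = ∀ C → ¬ IsCycle C

  IsTree : Set
  IsTree = Simple × Connected × Acyclic

  Incident : Fin n → Fin m → Set
  Incident v i = proj₁ (E i) ≡ v ⊎ proj₂ (E i) ≡ v

  incident? : ∀ v i → Dec (Incident v i)
  incident? v i = (proj₁ (E i) ≟ v) ⊎-dec (proj₂ (E i) ≟ v)

  degree : Fin n → ℕ
  degree v = length (filter (incident? v) (tabulate (λ i → i)))

  IsBinaryTree : Set
  IsBinaryTree = IsTree × (∀ v → degree v ≡ 1 ⊎ degree v ≡ 3)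

  Leaf : Fin n → Set
  Leaf v = degree v ≡ 1

  data UsesEdge (i : Fin m) : List (Fin n) → Set where
    here  : ∀ {u w r} → Joins i u w → UsesEdge i (u ∷ w ∷ r)
    there : ∀ {u r} → UsesEdge i r → UsesEdge i (u ∷ r)

  -- link (a , b) covers tree edge i: i lies on the (unique) a–b path in T
  Covers : Fin n × Fin n → Fin m → Set
  Covers (a , b) i = ∃ λ P → IsPath a b P × UsesEdge i P

xsum : {k : ℕ} → Vector ℚ k → Vector Bool k → ℚ
xsum {k} x S = foldr _+_ 0ℚ (λ ℓ → if S ℓ then x ℓ else 0ℚ)

Characterizes : {k : ℕ} → (Fin k → Set) → Vector Bool k → Set
Characterizes {k} P S = ∀ ℓ → (S ℓ ≡ true) ⇔ P ℓ

LinksBetweenLeaves : {n m k : ℕ} → EdgeList n m → (Fin k → Fin n × Fin n) → Set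
LinksBetweenLeaves E L = ∀ ℓ → Leaf E (proj₁ (L ℓ)) × Leaf E (proj₂ (L ℓ))
                              × proj₁ (L ℓ) ≢ proj₂ (L ℓ)

module _ {n m k : ℕ} (E : EdgeList n m) (L : Fin k → Fin n × Fin n) (x : Vector ℚ k) where

  IsDelta : Fin m → Vector Bool k → Set
  IsDelta e = Characterizes (λ ℓ → Covers E (L ℓ) e)

  IsDelta3 : Fin m → Fin m → Fin m → Vector Bool k → Set
  IsDelta3 e₁ e₂ e₃ = Characterizes
    (λ ℓ → Covers E (L ℓ) e₁ ⊎ Covers E (L ℓ) e₂ ⊎ Covers E (L ℓ) e₃)

  NodeLPFeasible : Set
  NodeLPFeasible =
      (∀ e S → IsDelta e S → (+ 1 / 1) ≤ xsum x S)
    × (∀ v → degree E v ≡ 3 → ∀ e₁ e₂ e₃ →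
         Incident E v e₁ → Incident E v e₂ → Incident E v e₃ →
         e₁ ≢ e₂ → e₁ ≢ e₃ → e₂ ≢ e₃ →
         ∀ S → IsDelta3 e₁ e₂ e₃ S → (+ 2 / 1) ≤ xsum x S)
    × (∀ ℓ → 0ℚ ≤ x ℓ)

  Deficient : Fin m → Set
  Deficient e = ∃ λ S → IsDelta e S × xsum x S < (+ 4 / 3)

module Submission where

-- A vertex v incident to three distinct edges e₁, e₂, e₃ of a binary tree has degree 3, so these
-- are all its edges. A link joins two leaves, so its tree path, if it covers some eᵢ, passes
-- through v as an interior vertex and leaves it along a second edge eⱼ. Summing over links,
-- 2 x(δ(e₁) ∪ δ(e₂) ∪ δ(e₃)) ≤ x(δ(e₁)) + x(δ(e₂)) + x(δ(e₃)); the left side is at least 4 by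
-- the degree-3 constraint, while three deficient edges would make the right side less than 4.

open import Defs
open import Data.Nat as ℕ using (ℕ; _≤_; s≤s)
open import Data.Fin using (Fin; zero; suc)
open import Data.Fin.Properties using (_≟_; injective⇒≤)
open import Data.Product using (_×_; ∃; ∃₂; _,_; proj₁; proj₂)
open import Data.Sum using (_⊎_; inj₁; inj₂; [_,_]′)
open import Data.Sum.Function.Propositional using (_⊎-⇔_)
open import Data.Rational as ℚ using (ℚ; 0ℚ; _+_; _/_)
open import Data.Rational.Properties as ℚ using (+-0-commutativeMonoid)
open import Data.Integer using (+_)
open import Data.Vec.Functional using (Vector; foldr)
open import Data.Bool using (Bool; true; false; if_then_else_; _∨_)
open import Data.Bool.Properties using (T-≡; T-∨)
open import Data.List using (List; []; _∷_; length; lookup; head; last)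
open import Data.List.Relation.Unary.Linked using (Linked; _∷_)
open import Data.List.Relation.Unary.AllPairs using ([]; _∷_)
open import Data.List.Relation.Unary.All as All using (All; []; _∷_)
open import Data.List.Relation.Unary.Any using (here; there)
open import Data.List.Relation.Unary.Unique.Propositional using (Unique)
open import Data.List.Membership.Propositional using (_∈_)
open import Data.List.Membership.Propositional.Properties using (∈-lookup; ∈-filter⁺; ∈-tabulate⁺)
open import Data.List.Membership.Setoid.Properties using (index-injective)
open import Data.List.Relation.Binary.Subset.Propositional using (_⊆_)
open import Data.Maybe using (just)
open import Data.Empty using (⊥-elim)
open import Function.Base using (id)
open import Function.Bundles using (_⇔_; Equivalence)
open import Function.Definitions using (Injective)
import Function.Properties.Equivalence as ⇔
open import Relation.Nullary using (¬_; yes; no)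
open import Relation.Binary.PropositionalEquality
  using (_≡_; _≢_; refl; sym; trans; cong; subst; ≢-sym; setoid)
open import Algebra.Properties.CommutativeMonoid.Sum +-0-commutativeMonoid using (∑-distrib-+)

lookup-injective : ∀ {A : Set} {xs : List A} → Unique xs → Injective _≡_ _≡_ (lookup xs)
lookup-injective (_    ∷ _)   {zero}  {zero}  _  = refl
lookup-injective (x∉xs ∷ _)   {zero}  {suc j} eq = ⊥-elim (All.lookup x∉xs (∈-lookup j) eq)
lookup-injective (x∉xs ∷ _)   {suc i} {zero}  eq = ⊥-elim (All.lookup x∉xs (∈-lookup i) (sym eq))
lookup-injective (_    ∷ xs!) {suc i} {suc j} eq = cong suc (lookup-injective xs! eq)

unique-⊆⇒length≤ : ∀ {A : Set} {xs ys : List A} → Unique xs → xs ⊆ ys → length xs ≤ length ys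
unique-⊆⇒length≤ {A} xs! xs⊆ys = injective⇒≤ λ eq →
  lookup-injective xs! (index-injective (setoid A) (xs⊆ys (∈-lookup _)) (xs⊆ys (∈-lookup _)) eq)

module _ {n m : ℕ} (E : EdgeList n m) where

  unique-incident⇒length≤degree : ∀ {v es} → Unique es → All (Incident E v) es → length es ≤ degree E v
  unique-incident⇒length≤degree {v} es! incident =
    unique-⊆⇒length≤ es! λ {e} e∈es → ∈-filter⁺ (incident? E v) (∈-tabulate⁺ {f = id} e) (All.lookup incident e∈es)

  three-incident⇒degree≡3 : ∀ {v e₁ e₂ e₃} → IsBinaryTree E →
    Incident E v e₁ → Incident E v e₂ → Incident E v e₃ → e₁ ≢ e₂ → e₁ ≢ e₃ → e₂ ≢ e₃ →
    degree E v ≡ 3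
  three-incident⇒degree≡3 {v} (_ , degree≡1∨3) i₁ i₂ i₃ e₁≢e₂ e₁≢e₃ e₂≢e₃ with degree≡1∨3 v
  ... | inj₂ degree≡3 = degree≡3
  ... | inj₁ degree≡1
    with s≤s () ← subst (3 ≤_) degree≡1 (unique-incident⇒length≤degree
      ((e₁≢e₂ ∷ e₁≢e₃ ∷ []) ∷ (e₂≢e₃ ∷ []) ∷ [] ∷ []) (i₁ ∷ i₂ ∷ i₃ ∷ []))

  degree≡3⇒incident-one-of : ∀ {v e₁ e₂ e₃ g} → degree E v ≡ 3 →
    Incident E v e₁ → Incident E v e₂ → Incident E v e₃ → e₁ ≢ e₂ → e₁ ≢ e₃ → e₂ ≢ e₃ →
    Incident E v g → g ≡ e₁ ⊎ g ≡ e₂ ⊎ g ≡ e₃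
  degree≡3⇒incident-one-of {v} {e₁} {e₂} {e₃} {g} degree≡3 i₁ i₂ i₃ e₁≢e₂ e₁≢e₃ e₂≢e₃ ig
    with g ≟ e₁ | g ≟ e₂ | g ≟ e₃
  ... | yes g≡e₁ | _        | _        = inj₁ g≡e₁
  ... | no _     | yes g≡e₂ | _        = inj₂ (inj₁ g≡e₂)
  ... | no _     | no _     | yes g≡e₃ = inj₂ (inj₂ g≡e₃)
  ... | no g≢e₁  | no g≢e₂  | no g≢e₃
    with s≤s (s≤s (s≤s ())) ← subst (4 ≤_) degree≡3 (unique-incident⇒length≤degree
      ((g≢e₁ ∷ g≢e₂ ∷ g≢e₃ ∷ []) ∷ (e₁≢e₂ ∷ e₁≢e₃ ∷ []) ∷ (e₂≢e₃ ∷ []) ∷ [] ∷ [])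
      (ig ∷ i₁ ∷ i₂ ∷ i₃ ∷ []))

  joins⇒endpoint : ∀ {i a b c d} → Joins E i a b → Joins E i c d → a ≡ c ⊎ a ≡ d
  joins⇒endpoint (inj₁ (p , _)) (inj₁ (r , _)) = inj₁ (trans (sym p) r)
  joins⇒endpoint (inj₁ (p , _)) (inj₂ (r , _)) = inj₂ (trans (sym p) r)
  joins⇒endpoint (inj₂ (_ , q)) (inj₁ (_ , s)) = inj₂ (trans (sym q) s)
  joins⇒endpoint (inj₂ (_ , q)) (inj₂ (_ , s)) = inj₁ (trans (sym q) s)

  joins-incident⇒endpoint : ∀ {i a b v} → Joins E i a b → Incident E v i → v ≡ a ⊎ v ≡ b
  joins-incident⇒endpoint (inj₁ (p , _)) (inj₁ r) = inj₁ (trans (sym r) p)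
  joins-incident⇒endpoint (inj₁ (_ , q)) (inj₂ r) = inj₂ (trans (sym r) q)
  joins-incident⇒endpoint (inj₂ (p , _)) (inj₁ r) = inj₂ (trans (sym r) p)
  joins-incident⇒endpoint (inj₂ (_ , q)) (inj₂ r) = inj₁ (trans (sym r) q)

  joins⇒incidentˡ : ∀ {i a b} → Joins E i a b → Incident E a i
  joins⇒incidentˡ (inj₁ (p , _)) = inj₁ p
  joins⇒incidentˡ (inj₂ (_ , q)) = inj₂ q

  joins⇒incidentʳ : ∀ {i a b} → Joins E i a b → Incident E b i
  joins⇒incidentʳ (inj₁ (_ , q)) = inj₂ q
  joins⇒incidentʳ (inj₂ (p , _)) = inj₁ p

  uses-incident⇒∈ : ∀ {e v P} → UsesEdge E e P → Incident E v e → v ∈ P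
  uses-incident⇒∈ (here e-uw) v∈e with joins-incident⇒endpoint e-uw v∈e
  ... | inj₁ refl = here refl
  ... | inj₂ refl = there (here refl)
  uses-incident⇒∈ (there uses) v∈e = there (uses-incident⇒∈ uses v∈e)

  interior-uses-two-incident-edges : ∀ {v} P → Linked (Adj E) P → Unique P → v ∈ P →
    head P ≢ just v → last P ≢ just v →
    ∃₂ λ g h → g ≢ h × Incident E v g × Incident E v h × UsesEdge E g P × UsesEdge E h P
  interior-uses-two-incident-edges (_ ∷ _) _ _ (here refl) head≢v _ = ⊥-elim (head≢v refl)
  interior-uses-two-incident-edges (_ ∷ _ ∷ []) _ _ (there (here refl)) _ last≢v = ⊥-elim (last≢v refl)
  interior-uses-two-incident-edges (_ ∷ _ ∷ _ ∷ _) ((g , g-uw) ∷ (h , h-wz) ∷ _)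
    ((u≢w ∷ u≢z ∷ _) ∷ _) (there (here refl)) _ _ =
    g , h , g≢h , joins⇒incidentʳ g-uw , joins⇒incidentˡ h-wz , here g-uw , there (here h-wz)
    where
    g≢h : g ≢ h
    g≢h refl = [ u≢w , u≢z ]′ (joins⇒endpoint g-uw h-wz)
  interior-uses-two-incident-edges (_ ∷ w ∷ r) (_ ∷ adj) (_ ∷ w∷r!@(w∉r ∷ _)) (there (there v∈r)) _ last≢v
    with g , h , g≢h , ig , ih , uses-g , uses-h ← interior-uses-two-incident-edges (w ∷ r) adj w∷r!
           (there v∈r) (λ { refl → All.lookup w∉r v∈r refl }) last≢v
    = g , h , g≢h , ig , ih , there uses-g , there uses-h

  leaf≢degree3 : ∀ {a v} → Leaf E a → degree E v ≡ 3 → just a ≢ just v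
  leaf≢degree3 leaf-a degree≡3 refl with () ← trans (sym leaf-a) degree≡3

  covers-another-incident-edge : ∀ {v a b e} → degree E v ≡ 3 → Leaf E a → Leaf E b →
    Covers E (a , b) e → Incident E v e → ∃ λ g → g ≢ e × Incident E v g × Covers E (a , b) g
  covers-another-incident-edge {e = e} degree≡3 leaf-a leaf-b
    (P , path@(head≡a , last≡b , adj , P!) , uses-e) v∈e
    with g , h , g≢h , ig , ih , uses-g , uses-h ← interior-uses-two-incident-edges P adj P!
           (uses-incident⇒∈ uses-e v∈e)
           (λ head≡v → leaf≢degree3 leaf-a degree≡3 (trans (sym head≡a) head≡v))
           (λ last≡v → leaf≢degree3 leaf-b degree≡3 (trans (sym last≡b) last≡v))
    with g ≟ e
  ... | yes refl = h , ≢-sym g≢h , ih , P , path , uses-h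
  ... | no g≢e   = g , g≢e , ig , P , path , uses-g

  δ₁⊆δ₂∪δ₃ : ∀ {k} {L : Fin k → Fin n × Fin n} {v e₁ e₂ e₃ S₁ S₂ S₃} →
    LinksBetweenLeaves E L → degree E v ≡ 3 →
    Incident E v e₁ → Incident E v e₂ → Incident E v e₃ → e₁ ≢ e₂ → e₁ ≢ e₃ → e₂ ≢ e₃ →
    Characterizes (λ ℓ → Covers E (L ℓ) e₁) S₁ →
    Characterizes (λ ℓ → Covers E (L ℓ) e₂) S₂ →
    Characterizes (λ ℓ → Covers E (L ℓ) e₃) S₃ →
    ∀ ℓ → S₁ ℓ ≡ true → S₂ ℓ ≡ true ⊎ S₃ ℓ ≡ true
  δ₁⊆δ₂∪δ₃ leaves degree≡3 i₁ i₂ i₃ e₁≢e₂ e₁≢e₃ e₂≢e₃ δ₁ δ₂ δ₃ ℓ ℓ∈S₁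
    with g , g≢e₁ , ig , covers-g ← covers-another-incident-edge degree≡3
           (proj₁ (leaves ℓ)) (proj₁ (proj₂ (leaves ℓ))) (Equivalence.to (δ₁ ℓ) ℓ∈S₁) i₁
    with degree≡3⇒incident-one-of degree≡3 i₁ i₂ i₃ e₁≢e₂ e₁≢e₃ e₂≢e₃ ig
  ... | inj₁ refl        = ⊥-elim (g≢e₁ refl)
  ... | inj₂ (inj₁ refl) = inj₁ (Equivalence.from (δ₂ ℓ) covers-g)
  ... | inj₂ (inj₂ refl) = inj₂ (Equivalence.from (δ₃ ℓ) covers-g)

_∪_ : ∀ {k} → Vector Bool k → Vector Bool k → Vector Bool k
(S ∪ T) ℓ = S ℓ ∨ T ℓ

∨≡true⇔ : ∀ {b c} → (b ∨ c ≡ true) ⇔ (b ≡ true ⊎ c ≡ true)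
∨≡true⇔ = ⇔.trans (⇔.sym T-≡) (⇔.trans T-∨ (T-≡ ⊎-⇔ T-≡))

∪-characterizes : ∀ {k} {P Q : Fin k → Set} {S T} →
  Characterizes P S → Characterizes Q T → Characterizes (λ ℓ → P ℓ ⊎ Q ℓ) (S ∪ T)
∪-characterizes S⇔P T⇔Q ℓ = ⇔.trans ∨≡true⇔ (S⇔P ℓ ⊎-⇔ T⇔Q ℓ)

sum-mono-≤ : ∀ {k} {f g : Vector ℚ k} → (∀ ℓ → f ℓ ℚ.≤ g ℓ) → foldr _+_ 0ℚ f ℚ.≤ foldr _+_ 0ℚ g
sum-mono-≤ {ℕ.zero} _   = ℚ.≤-refl
sum-mono-≤ {ℕ.suc _} f≤g = ℚ.+-mono-≤ (f≤g zero) (sum-mono-≤ (λ ℓ → f≤g (suc ℓ)))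

double-select-∨≤select-sum : ∀ {a : ℚ} b₁ b₂ b₃ → 0ℚ ℚ.≤ a →
  (b₁ ≡ true → b₂ ≡ true ⊎ b₃ ≡ true) →
  (b₂ ≡ true → b₁ ≡ true ⊎ b₃ ≡ true) →
  (b₃ ≡ true → b₁ ≡ true ⊎ b₂ ≡ true) →
  (if b₁ ∨ (b₂ ∨ b₃) then a else 0ℚ) + (if b₁ ∨ (b₂ ∨ b₃) then a else 0ℚ)
    ℚ.≤ (if b₁ then a else 0ℚ) + ((if b₂ then a else 0ℚ) + (if b₃ then a else 0ℚ))
double-select-∨≤select-sum {a} true true true 0≤a _ _ _ =
  ℚ.+-monoʳ-≤ a (subst (ℚ._≤ a + a) (ℚ.+-identityˡ a) (ℚ.+-monoˡ-≤ a 0≤a))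
double-select-∨≤select-sum {a} true  true  false _ _ _ _ = ℚ.≤-reflexive (cong (_+_ a) (sym (ℚ.+-identityʳ a)))
double-select-∨≤select-sum {a} true  false true  _ _ _ _ = ℚ.≤-reflexive (cong (_+_ a) (sym (ℚ.+-identityˡ a)))
double-select-∨≤select-sum {a} false true  true  _ _ _ _ = ℚ.≤-reflexive (sym (ℚ.+-identityˡ (a + a)))
double-select-∨≤select-sum true  false false _ h₁ _ _ = ⊥-elim ([ (λ ()) , (λ ()) ]′ (h₁ refl))
double-select-∨≤select-sum false true  false _ _ h₂ _ = ⊥-elim ([ (λ ()) , (λ ()) ]′ (h₂ refl))
double-select-∨≤select-sum false false true  _ _ _ h₃ = ⊥-elim ([ (λ ()) , (λ ()) ]′ (h₃ refl))
double-select-∨≤select-sum false false false _ _ _ _ = ℚ.≤-refl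

xsum-double-∪≤xsum-sum : ∀ {k} (x : Vector ℚ k) {S₁ S₂ S₃ : Vector Bool k} → (∀ ℓ → 0ℚ ℚ.≤ x ℓ) →
  (∀ ℓ → S₁ ℓ ≡ true → S₂ ℓ ≡ true ⊎ S₃ ℓ ≡ true) →
  (∀ ℓ → S₂ ℓ ≡ true → S₁ ℓ ≡ true ⊎ S₃ ℓ ≡ true) →
  (∀ ℓ → S₃ ℓ ≡ true → S₁ ℓ ≡ true ⊎ S₂ ℓ ≡ true) →
  xsum x (S₁ ∪ (S₂ ∪ S₃)) + xsum x (S₁ ∪ (S₂ ∪ S₃)) ℚ.≤ xsum x S₁ + (xsum x S₂ + xsum x S₃)
xsum-double-∪≤xsum-sum x {S₁} {S₂} {S₃} x≥0 h₁ h₂ h₃ = begin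
  xsum x S + xsum x S                       ≡⟨ ∑-distrib-+ (select S) (select S) ⟨
  foldr _+_ 0ℚ (λ ℓ → select S ℓ + select S ℓ)
    ≤⟨ sum-mono-≤ (λ ℓ → double-select-∨≤select-sum (S₁ ℓ) (S₂ ℓ) (S₃ ℓ) (x≥0 ℓ) (h₁ ℓ) (h₂ ℓ) (h₃ ℓ)) ⟩
  foldr _+_ 0ℚ (λ ℓ → select S₁ ℓ + (select S₂ ℓ + select S₃ ℓ))
    ≡⟨ ∑-distrib-+ (select S₁) (λ ℓ → select S₂ ℓ + select S₃ ℓ) ⟩
  xsum x S₁ + foldr _+_ 0ℚ (λ ℓ → select S₂ ℓ + select S₃ ℓ)
    ≡⟨ cong (_+_ (xsum x S₁)) (∑-distrib-+ (select S₂) (select S₃)) ⟩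
  xsum x S₁ + (xsum x S₂ + xsum x S₃)       ∎
  where
  open ℚ.≤-Reasoning
  S : Vector Bool _
  S = S₁ ∪ (S₂ ∪ S₃)
  select : Vector Bool _ → Vector ℚ _
  select T ℓ = if T ℓ then x ℓ else 0ℚ

mainTheorem4 : (n m k : ℕ) (E : EdgeList n m) (L : Fin k → Fin n × Fin n) (x : Vector ℚ k) →
    IsBinaryTree E → LinksBetweenLeaves E L → NodeLPFeasible E L x →
    ∀ v → ¬ (∃ λ e₁ → ∃ λ e₂ → ∃ λ e₃ →
      Incident E v e₁ × Incident E v e₂ × Incident E v e₃ ×
      e₁ ≢ e₂ × e₁ ≢ e₃ × e₂ ≢ e₃ ×
      Deficient E L x e₁ × Deficient E L x e₂ × Deficient E L x e₃)
mainTheorem4 n m k E L x tree leaves (_ , node-constraint , x≥0) v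
  (e₁ , e₂ , e₃ , i₁ , i₂ , i₃ , e₁≢e₂ , e₁≢e₃ , e₂≢e₃ , (S₁ , δ₁ , <₁) , (S₂ , δ₂ , <₂) , (S₃ , δ₃ , <₃)) =
  ℚ.<-irrefl 2+2≡4/3+4/3+4/3 (ℚ.≤-<-trans (ℚ.≤-trans (ℚ.+-mono-≤ two≤ two≤) double≤sum) (ℚ.+-mono-< <₁ (ℚ.+-mono-< <₂ <₃)))
  where
  degree≡3 : degree E v ≡ 3
  degree≡3 = three-incident⇒degree≡3 E tree i₁ i₂ i₃ e₁≢e₂ e₁≢e₃ e₂≢e₃
  two≤ : + 2 / 1 ℚ.≤ xsum x (S₁ ∪ (S₂ ∪ S₃))
  two≤ = node-constraint v degree≡3 e₁ e₂ e₃ i₁ i₂ i₃ e₁≢e₂ e₁≢e₃ e₂≢e₃ _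
    (∪-characterizes δ₁ (∪-characterizes δ₂ δ₃))
  double≤sum : xsum x (S₁ ∪ (S₂ ∪ S₃)) + xsum x (S₁ ∪ (S₂ ∪ S₃)) ℚ.≤ xsum x S₁ + (xsum x S₂ + xsum x S₃)
  double≤sum = xsum-double-∪≤xsum-sum x x≥0
    (δ₁⊆δ₂∪δ₃ E leaves degree≡3 i₁ i₂ i₃ e₁≢e₂ e₁≢e₃ e₂≢e₃ δ₁ δ₂ δ₃)
    (δ₁⊆δ₂∪δ₃ E leaves degree≡3 i₂ i₁ i₃ (≢-sym e₁≢e₂) e₂≢e₃ e₁≢e₃ δ₂ δ₁ δ₃)
    (δ₁⊆δ₂∪δ₃ E leaves degree≡3 i₃ i₁ i₂ (≢-sym e₁≢e₃) (≢-sym e₂≢e₃) e₁≢e₂ δ₃ δ₁ δ₂)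
  2+2≡4/3+4/3+4/3 : + 2 / 1 + + 2 / 1 ≡ + 4 / 3 + (+ 4 / 3 + + 4 / 3)
  2+2≡4/3+4/3+4/3 = refl
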